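{- Let $k,n$ be positive integers, and put $a=2k$ and $b=an+2$. For positive integers $t$, let $C^{(+)}_{t,n}$ denote the number of $(t,\,tn+1)$-Dyck paths; since $\gcd(t,tn+1)=1$, this equals $\frac{1}{t(n+1)+1}\binom{t(n+1)+1}{t}$. Then the number $|\mathscr{D}_{a,b}|$ of $(a,b)$-Dyck paths satisfies \[ |\mathscr{D}_{a,b}| = C^{(+)}_{a,n}+\sum_{j=1}^{k} C^{(+)}_{a-j,n}\,C^{(+)}_{j,n}. \]
   Context: For positive integers $a,b$, an $(a,b)$-Dyck path is a lattice path from $(0,a)$ to $(b,0)$ using unit steps $(1,0)$ (east) and $(0,-1)$ (south) which never goes strictly above the line segment joining $(0,a)$ to $(b,0)$ (touching the segment is allowed). Equivalently, it is determined by the sequence $(\lambda_{a-1},\dots,\lambda_1)$ of nonnegative integers, weakly increasing from $\lambda_{a-1}$ to $\lambda_1$, with $\lambda_{a-l}\le \lfloor bl/a\rfloor$ for $1\le l\le a-1$ (the numbers of unit boxes to the left of the path in the rows of the $a\times b$ rectangle). $\mathscr{D}_{a,b}$ denotes the set of $(a,b)$-Dyck paths. It is standard that when $\gcd(a,b)=1$, $|\mathscr{D}_{a,b}|=\frac{1}{a+b}\binom{a+b}{a}$. -}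

module Defs where

open import Data.Nat using (ℕ; zero; suc; _+_; _*_; _∸_; _≤_; NonZero)
open import Data.Nat.DivMod using (_/_)
open import Data.Vec using (Vec; []; _∷_)
open import Data.Fin using (Fin)
open import Data.Product using (Σ; _×_)
open import Data.Sum using (_⊎_)

-- A vector μ₁ … μ_m (μ_l = λ_{a-l}) is weakly increasing in the index l
-- (i.e. λ is weakly increasing from λ_{a-1} to λ_1).
data Increasing : {m : ℕ} → Vec ℕ m → Set where
  inc-[]  : Increasing []
  inc-[x] : ∀ x → Increasing (x ∷ [])
  inc-∷   : ∀ {m} x y (v : Vec ℕ m) → x ≤ y → Increasing (y ∷ v) → Increasing (x ∷ y ∷ v)

-- ⌊ m / a ⌋ (convention: 0 when a = 0; only a ≥ 1 is ever used).
⌊_/_⌋ : ℕ → ℕ → ℕ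
⌊ m / zero ⌋  = 0
⌊ m / suc a ⌋ = m / suc a

data Bounded (a b : ℕ) : (l : ℕ) → {m : ℕ} → Vec ℕ m → Set where
  bd-[] : ∀ {l} → Bounded a b l []
  bd-∷  : ∀ {l m} x (v : Vec ℕ m) → x ≤ ⌊ b * l / a ⌋ → Bounded a b (suc l) v → Bounded a b l (x ∷ v)

-- (a,b)-Dyck paths, encoded by (λ_{a-1}, …, λ_1) stored as (μ_1, …, μ_{a-1}),
-- μ_l = λ_{a-l}: nonnegative, weakly increasing, μ_l ≤ ⌊b l / a⌋.
record DyckPath (a b : ℕ) : Set where
  constructor dyck
  field
    rows    : Vec ℕ (a ∸ 1)
    mono    : Increasing rows
    bounded : Bounded a b 1 rows

Disj1to : ℕ → (ℕ → Set) → Set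
Disj1to zero    F = Fin 0
Disj1to (suc k) F = Disj1to k F ⊎ F (suc k)

module Submission where

-- Write a = 2K (K = k + 1), N = n + 1.  An (a, aN+2)-Dyck path is a weakly
-- increasing list of a - 1 row lengths x_1, …, x_{a-1} with x_l ≤ ⌊(aN+2) l / a⌋
-- (a "staircase" under that ceiling), and for l < a this ceiling equals
-- N l + [K ≤ l].  Likewise (t, tN+1)-Dyck paths are the staircases of t - 1 rows
-- under the ceiling N l.  So a path either stays under N l on every row, giving an
-- (a, aN+1)-path, or it first exceeds N l at some row s ≥ K, where necessarily
-- x_s = N s + 1.  Cutting there, the rows before s form an (s, sN+1)-path and the
-- rows after s, lowered by N s + 1, form a (j, jN+1)-path with j = a - s ≤ K.

open import Defs
open import Data.Nat using (ℕ; zero; suc; _+_; _*_; _∸_; _≤_; _<_; z≤n; s≤s; s≤s⁻¹; z<s; _≤?_; _/_)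
open import Data.Nat.Properties
open import Data.Nat.DivMod using (m*n/n≡m; m<n⇒m/n≡0; +-distrib-/-∣ˡ; m*n/m*o≡n/o; m/n≡1+[m∸n]/n)
open import Data.Nat.Divisibility using (divides)
open import Data.Nat.Tactic.RingSolver using (solve-∀)
open import Data.List using (List; []; _∷_; length; map)
open import Data.List.Properties using (length-map; map-injective; ∷-injective)
open import Data.Vec using (Vec; []; _∷_; toList)
open import Data.Vec.Properties using (length-toList)
open import Data.Product using (Σ; _×_; _,_; proj₁; proj₂)
open import Data.Sum using (_⊎_; inj₁; inj₂)
open import Data.Empty using (⊥-elim)
open import Relation.Nullary using (¬_; yes; no)
open import Relation.Binary.PropositionalEquality
open import Function.Bundles using (_↔_; mk↔ₛ′; Inverse)
open import Function.Properties.Inverse using (↔-refl; ↔-sym; ↔-trans)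
open import Function.Related.Propositional using (bijection; module EquationalReasoning)
open import Data.Sum.Function.Propositional using (_⊎-↔_)
open import Data.Product.Function.NonDependent.Propositional using (_×-↔_)
open import Data.Product.Function.Dependent.Propositional using (Σ-↔)

data Staircase (f : ℕ → ℕ) : (lo l : ℕ) → List ℕ → Set where
  done : ∀ {lo l} → Staircase f lo l []
  step : ∀ {lo l x xs} → lo ≤ x → x ≤ f l → Staircase f x (suc l) xs → Staircase f lo l (x ∷ xs)

Stairs : (ℕ → ℕ) → ℕ → Set
Stairs f m = Σ (List ℕ) λ xs → length xs ≡ m × Staircase f 0 1 xs

staircase-irrelevant : ∀ {f lo l xs} (s s′ : Staircase f lo l xs) → s ≡ s′
staircase-irrelevant done done = refl
staircase-irrelevant (step p q s) (step p′ q′ s′)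
  rewrite ≤-irrelevant p p′ | ≤-irrelevant q q′ | staircase-irrelevant s s′ = refl

stairs-≡ : ∀ {f m} {s s′ : Stairs f m} → proj₁ s ≡ proj₁ s′ → s ≡ s′
stairs-≡ {s = xs , e , s} {.xs , e′ , s′} refl =
  cong₂ (λ u v → xs , u , v) (≡-irrelevant e e′) (staircase-irrelevant s s′)

staircase-lower : ∀ {f lo lo′ l xs} → lo′ ≤ lo → Staircase f lo l xs → Staircase f lo′ l xs
staircase-lower _ done = done
staircase-lower lo′≤lo (step lo≤x x≤ s) = step (≤-trans lo′≤lo lo≤x) x≤ s

staircase-mono : ∀ {f f′ lo l xs} → (∀ i → i < l + length xs → f i ≤ f′ i) →
                 Staircase f lo l xs → Staircase f′ lo l xs
staircase-mono _ done = done
staircase-mono {l = l} {xs = x ∷ xs} f≤f′ (step lo≤x x≤ s) =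
  step lo≤x (≤-trans x≤ (f≤f′ l (m<m+n l z<s)))
       (staircase-mono (λ i i< → f≤f′ i (subst (i <_) (sym (+-suc l (length xs))) i<)) s)

stairs-ext : ∀ {f f′ m} → (∀ i → i ≤ m → f i ≡ f′ i) → Stairs f m ↔ Stairs f′ m
stairs-ext {m = m} f≡f′ =
  mk↔ₛ′ (recast f≡f′) (recast (λ i i≤ → sym (f≡f′ i i≤))) (λ _ → stairs-≡ refl) (λ _ → stairs-≡ refl)
  where
  recast : ∀ {g g′} → (∀ i → i ≤ m → g i ≡ g′ i) → Stairs g m → Stairs g′ m
  recast g≡g′ (xs , e , s) =
    xs , e , staircase-mono (λ i i< → ≤-reflexive (g≡g′ i (subst (i ≤_) e (s≤s⁻¹ i<)))) s

stairs-resize : ∀ {f m m′} → m ≡ m′ → Stairs f m ↔ Stairs f m′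
stairs-resize refl = ↔-refl

dyckCeiling : ℕ → ℕ → ℕ → ℕ
dyckCeiling a b l = ⌊ b * l / a ⌋

increasing-irrelevant : ∀ {m} {v : Vec ℕ m} (p q : Increasing v) → p ≡ q
increasing-irrelevant inc-[] inc-[] = refl
increasing-irrelevant (inc-[x] _) (inc-[x] _) = refl
increasing-irrelevant (inc-∷ x y v p i) (inc-∷ _ _ _ p′ i′) =
  cong₂ (inc-∷ x y v) (≤-irrelevant p p′) (increasing-irrelevant i i′)

bounded-irrelevant : ∀ {a b l m} {v : Vec ℕ m} (p q : Bounded a b l v) → p ≡ q
bounded-irrelevant bd-[] bd-[] = refl
bounded-irrelevant (bd-∷ x v p i) (bd-∷ _ _ p′ i′) =
  cong₂ (bd-∷ x v) (≤-irrelevant p p′) (bounded-irrelevant i i′)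

dyck-≡ : ∀ {a b} {d e : DyckPath a b} → DyckPath.rows d ≡ DyckPath.rows e → d ≡ e
dyck-≡ {d = dyck v i b} {dyck .v i′ b′} refl =
  cong₂ (dyck v) (increasing-irrelevant i i′) (bounded-irrelevant b b′)

vec-staircase : ∀ {a b l m x} {v : Vec ℕ m} → Increasing (x ∷ v) → Bounded a b l (x ∷ v) →
                Staircase (dyckCeiling a b) x l (x ∷ toList v)
vec-staircase (inc-[x] _) (bd-∷ _ _ x≤ bd-[]) = step ≤-refl x≤ done
vec-staircase (inc-∷ _ _ _ x≤y inc) (bd-∷ _ _ x≤ bd) =
  step ≤-refl x≤ (staircase-lower x≤y (vec-staircase inc bd))

rows-staircase : ∀ {a b l m} (v : Vec ℕ m) → Increasing v → Bounded a b l v →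
                 Staircase (dyckCeiling a b) 0 l (toList v)
rows-staircase [] _ _ = done
rows-staircase (x ∷ v) inc bd = staircase-lower z≤n (vec-staircase inc bd)

staircase-rows : ∀ {a b lo l m} (v : Vec ℕ m) → Staircase (dyckCeiling a b) lo l (toList v) →
                 Increasing v × Bounded a b l v
staircase-rows [] done = inc-[] , bd-[]
staircase-rows (x ∷ []) (step _ x≤ done) = inc-[x] x , bd-∷ x [] x≤ bd-[]
staircase-rows {a} {b} (x ∷ y ∷ v) (step _ x≤ s@(step x≤y _ _))
  with staircase-rows {a} {b} (y ∷ v) s
... | inc , bd = inc-∷ x y v x≤y inc , bd-∷ x (y ∷ v) x≤ bd

listToVec : ∀ {m} (xs : List ℕ) → length xs ≡ m → Vec ℕ m
listToVec {zero} [] _ = []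
listToVec {suc m} (x ∷ xs) e = x ∷ listToVec xs (suc-injective e)

toList-listToVec : ∀ {m} (xs : List ℕ) (e : length xs ≡ m) → toList (listToVec xs e) ≡ xs
toList-listToVec {zero} [] _ = refl
toList-listToVec {suc m} (x ∷ xs) e = cong (x ∷_) (toList-listToVec xs (suc-injective e))

listToVec-toList : ∀ {m} (v : Vec ℕ m) (e : length (toList v) ≡ m) → listToVec (toList v) e ≡ v
listToVec-toList [] _ = refl
listToVec-toList (x ∷ v) e = cong (x ∷_) (listToVec-toList v (suc-injective e))

dyck-stairs : ∀ {a b} → DyckPath a b ↔ Stairs (dyckCeiling a b) (a ∸ 1)
dyck-stairs {a} {b} = mk↔ₛ′ to from
  (λ { (xs , e , _) → stairs-≡ (toList-listToVec xs e) })
  (λ { (dyck v _ _) → dyck-≡ (listToVec-toList v _) })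
  where
  to : DyckPath a b → Stairs (dyckCeiling a b) (a ∸ 1)
  to (dyck v inc bd) = toList v , length-toList v , rows-staircase {a} {b} v inc bd
  from : Stairs (dyckCeiling a b) (a ∸ 1) → DyckPath a b
  from (xs , e , s) = dyck v (proj₁ v-ok) (proj₂ v-ok)
    where
    v : Vec ℕ (a ∸ 1)
    v = listToVec xs e
    v-ok : Increasing v × Bounded a b 1 v
    v-ok = staircase-rows {a} {b} v (subst (Staircase _ 0 1) (sym (toList-listToVec xs e)) s)

floor-linear : ∀ t N r l → dyckCeiling (suc t) (suc t * N + r) l ≡ N * l + r * l / suc t
floor-linear t N r l = begin
  (suc t * N + r) * l / suc t            ≡⟨ cong (_/ suc t) (expand (suc t) N r l) ⟩
  (N * l * suc t + r * l) / suc t        ≡⟨ +-distrib-/-∣ˡ (r * l) (divides (N * l) refl) ⟩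
  N * l * suc t / suc t + r * l / suc t  ≡⟨ cong (_+ r * l / suc t) (m*n/n≡m (N * l) (suc t)) ⟩
  N * l + r * l / suc t                  ∎
  where
  open ≡-Reasoning
  expand : ∀ t N r l → (t * N + r) * l ≡ N * l * t + r * l
  expand = solve-∀

floor-coprime : ∀ t N l → l ≤ t ∸ 1 → dyckCeiling t (t * N + 1) l ≡ N * l
floor-coprime zero N zero _ = sym (*-zeroʳ N)
floor-coprime (suc t) N l l≤t = begin
  dyckCeiling (suc t) (suc t * N + 1) l  ≡⟨ floor-linear t N 1 l ⟩
  N * l + 1 * l / suc t                  ≡⟨ cong (N * l +_) (m<n⇒m/n≡0 (s≤s (subst (_≤ t) (sym (*-identityˡ l)) l≤t))) ⟩
  N * l + 0                              ≡⟨ +-identityʳ (N * l) ⟩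
  N * l                                  ∎
  where open ≡-Reasoning

atLeast : ℕ → ℕ → ℕ
atLeast zero    _       = 1
atLeast (suc K) zero    = 0
atLeast (suc K) (suc l) = atLeast K l

atLeast-≥ : ∀ {K l} → K ≤ l → atLeast K l ≡ 1
atLeast-≥ {zero} _ = refl
atLeast-≥ {suc K} (s≤s K≤l) = atLeast-≥ K≤l

atLeast-< : ∀ {K l} → l < K → atLeast K l ≡ 0
atLeast-< {suc K} {zero} _ = refl
atLeast-< {suc K} {suc l} (s≤s l<K) = atLeast-< l<K

floor-half : ∀ k l → l < 2 * suc k → l / suc k ≡ atLeast (suc k) l
floor-half k l l<2K with suc k ≤? l
... | yes K≤l = begin
  l / suc k                  ≡⟨ m/n≡1+[m∸n]/n K≤l ⟩
  suc ((l ∸ suc k) / suc k)  ≡⟨ cong suc (m<n⇒m/n≡0 (m<n+o⇒m∸n<o l (suc k) l<K+K)) ⟩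
  1                          ≡⟨ sym (atLeast-≥ K≤l) ⟩
  atLeast (suc k) l          ∎
  where
  open ≡-Reasoning
  l<K+K : l < suc k + suc k
  l<K+K = subst (l <_) (cong (suc k +_) (+-identityʳ (suc k))) l<2K
... | no K≰l = trans (m<n⇒m/n≡0 (≰⇒> K≰l)) (sym (atLeast-< (≰⇒> K≰l)))

floor-even : ∀ k N l → l ≤ 2 * suc k ∸ 1 →
             dyckCeiling (2 * suc k) (2 * suc k * N + 2) l ≡ N * l + atLeast (suc k) l
floor-even k N l l≤ = begin
  dyckCeiling (2 * suc k) (2 * suc k * N + 2) l  ≡⟨ floor-linear (2 * suc k ∸ 1) N 2 l ⟩
  N * l + 2 * l / (2 * suc k)                    ≡⟨ cong (N * l +_) (m*n/m*o≡n/o 2 l (suc k)) ⟩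
  N * l + l / suc k                              ≡⟨ cong (N * l +_) (floor-half k l (s≤s l≤)) ⟩
  N * l + atLeast (suc k) l                      ∎
  where open ≡-Reasoning

-- Arithmetic of cutting m = p + (1 + q) rows around a hit at row p + 1 ≥ K.
cut-arith : ∀ {K p q m} → p + suc q ≡ m → K ≤ p + 1 → (q < m × K + q ≤ m) × p ≡ m ∸ suc q
cut-arith {K} {p} {q} refl K≤ =
  (m≤n+m (suc q) p , K+q≤) , sym (m+n∸n≡m p (suc q))
  where
  K+q≤ : K + q ≤ p + suc q
  K+q≤ = ≤-trans (+-monoˡ-≤ q K≤) (≤-reflexive (+-assoc p 1 q))

glue-arith : ∀ {K p q m} → p ≡ m ∸ suc q → q < m → K + q ≤ m → p + suc q ≡ m × K ≤ p + 1
glue-arith {K} {q = q} {m} refl q<m K+q≤m =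
  m∸n+n≡m q<m , +-cancelʳ-≤ q K _ (≤-trans K+q≤m (≤-reflexive (sym rows)))
  where
  rows : (m ∸ suc q) + 1 + q ≡ m
  rows = trans (+-assoc (m ∸ suc q) 1 q) (m∸n+n≡m q<m)

module FirstExcess (K N : ℕ) where

  below : ℕ → ℕ
  below l = N * l

  ceiling : ℕ → ℕ
  ceiling l = N * l + atLeast K l

  -- The only value a row l can take above `below l` and under `ceiling l`.
  hit : ℕ → ℕ
  hit l = suc (N * l)

  below≤ceiling : ∀ l → below l ≤ ceiling l
  below≤ceiling l = m≤m+n (N * l) (atLeast K l)

  ceiling-at-hit : ∀ {l} → K ≤ l → ceiling l ≡ hit l
  ceiling-at-hit {l} K≤l = trans (cong (N * l +_) (atLeast-≥ K≤l)) (+-comm (N * l) 1)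

  ceiling-shift : ∀ {l} i → K ≤ l → ceiling (i + l) ≡ hit l + below i
  ceiling-shift {l} i K≤l = begin
    ceiling (i + l)      ≡⟨ ceiling-at-hit (≤-trans K≤l (m≤n+m l i)) ⟩
    suc (N * (i + l))    ≡⟨ cong suc (*-distribˡ-+ N i l) ⟩
    suc (N * i + N * l)  ≡⟨ cong suc (+-comm (N * i) (N * l)) ⟩
    hit l + below i      ∎
    where open ≡-Reasoning

  excess-is-hit : ∀ {x l} → x ≤ ceiling l → ¬ x ≤ below l → K ≤ l × x ≡ hit l
  excess-is-hit {x} {l} x≤ x≰ with K ≤? l
  ... | yes K≤l = K≤l , ≤-antisym (≤-trans x≤ (≤-reflexive (ceiling-at-hit K≤l))) (≰⇒> x≰)
  ... | no K≰l = ⊥-elim (x≰ (≤-trans x≤ (≤-reflexive no-jump)))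
    where
    no-jump : ceiling l ≡ below l
    no-jump = trans (cong (N * l +_) (atLeast-< (≰⇒> K≰l))) (+-identityʳ (N * l))

  tail-up : ∀ {l lo i zs} → K ≤ l → Staircase below lo i zs →
            Staircase ceiling (hit l + lo) (i + l) (map (hit l +_) zs)
  tail-up K≤l done = done
  tail-up {l} {i = i} K≤l (step lo≤z z≤ s) =
    step (+-monoʳ-≤ (hit l) lo≤z)
         (≤-trans (+-monoʳ-≤ (hit l) z≤) (≤-reflexive (sym (ceiling-shift i K≤l))))
         (tail-up K≤l s)

  tail-down : ∀ {l lo i xs} → K ≤ l → hit l ≤ lo → Staircase ceiling lo (i + l) xs →
              Σ (List ℕ) λ zs → xs ≡ map (hit l +_) zs × Staircase below (lo ∸ hit l) i zs
  tail-down K≤l _ done = [] , refl , done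
  tail-down {l} {i = i} K≤l hit≤lo (step {x = x} lo≤x x≤ s)
    with tail-down K≤l (≤-trans hit≤lo lo≤x) s
  ... | zs , refl , s′ =
    x ∸ hit l ∷ zs ,
    cong (_∷ map (hit l +_) zs) (sym (m+[n∸m]≡n (≤-trans hit≤lo lo≤x))) ,
    step (∸-monoˡ-≤ (hit l) lo≤x)
         (m≤n+o⇒m∸n≤o x (hit l) (≤-trans x≤ (≤-reflexive (ceiling-shift i K≤l))))
         s′

  insertHit : ℕ → List ℕ → List ℕ → List ℕ
  insertHit l []       zs = hit l ∷ map (hit l +_) zs
  insertHit l (y ∷ ys) zs = y ∷ insertHit (suc l) ys zs

  length-insertHit : ∀ l ys zs → length (insertHit l ys zs) ≡ length ys + suc (length zs)
  length-insertHit l []       zs = cong suc (length-map (hit l +_) zs)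
  length-insertHit l (y ∷ ys) zs = cong suc (length-insertHit (suc l) ys zs)

  insertHit-staircase : ∀ {lo l ys zs} → lo ≤ below l → Staircase below lo l ys →
                        K ≤ length ys + l → Staircase below 0 1 zs →
                        Staircase ceiling lo l (insertHit l ys zs)
  insertHit-staircase lo≤ done K≤l gz =
    step (m≤n⇒m≤1+n lo≤) (≤-reflexive (sym (ceiling-at-hit K≤l)))
         (staircase-lower (m≤m+n _ 0) (tail-up K≤l gz))
  insertHit-staircase {l = l} {ys = y ∷ ys} _ (step lo≤y y≤ gy) K≤ gz =
    step lo≤y (≤-trans y≤ (below≤ceiling l))
         (insertHit-staircase (≤-trans y≤ (*-monoʳ-≤ N (n≤1+n l))) gy
                              (subst (K ≤_) (sym (+-suc (length ys) l)) K≤) gz)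

  insertHit-not-below : ∀ {lo l} ys {zs} → ¬ Staircase below lo l (insertHit l ys zs)
  insertHit-not-below []       (step _ hit≤ _) = <-irrefl refl hit≤
  insertHit-not-below (y ∷ ys) (step _ _ s)    = insertHit-not-below ys s

  insertHit-injective : ∀ {lo lo′ l} ys ys′ {zs zs′} →
                        Staircase below lo l ys → Staircase below lo′ l ys′ →
                        insertHit l ys zs ≡ insertHit l ys′ zs′ → ys ≡ ys′ × zs ≡ zs′
  insertHit-injective {l = l} [] [] _ _ eq =
    refl , map-injective (+-cancelˡ-≡ (hit l) _ _) (proj₂ (∷-injective eq))
  insertHit-injective [] (y′ ∷ _) _ (step _ y′≤ _) eq =
    ⊥-elim (<-irrefl refl (subst (_≤ _) (sym (proj₁ (∷-injective eq))) y′≤))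
  insertHit-injective (y ∷ _) [] (step _ y≤ _) _ eq =
    ⊥-elim (<-irrefl refl (subst (_≤ _) (proj₁ (∷-injective eq)) y≤))
  insertHit-injective (y ∷ ys) (y′ ∷ ys′) (step _ _ s) (step _ _ s′) eq
    with ∷-injective eq
  ... | refl , tail-eq with insertHit-injective ys ys′ s s′ tail-eq
  ... | refl , refl = refl , refl

  data Excess (lo l : ℕ) : List ℕ → Set where
    within  : ∀ {xs} → Staircase below lo l xs → Excess lo l xs
    exceeds : ∀ {ys zs} → Staircase below lo l ys → K ≤ length ys + l →
              Staircase below 0 1 zs → Excess lo l (insertHit l ys zs)

  excess : ∀ {lo l xs} → Staircase ceiling lo l xs → Excess lo l xs
  excess done = within done
  excess {lo} {l} (step {x = x} lo≤x x≤ s) with x ≤? below l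
  ... | yes x≤b = extend (excess s)
    where
    extend : ∀ {xs} → Excess x (suc l) xs → Excess lo l (x ∷ xs)
    extend (within r) = within (step lo≤x x≤b r)
    extend (exceeds {ys} r K≤ gz) = exceeds (step lo≤x x≤b r) (subst (K ≤_) (+-suc (length ys) l) K≤) gz
  ... | no x≰b with excess-is-hit x≤ x≰b
  ... | K≤l , refl with tail-down K≤l ≤-refl s
  ... | zs , refl , gz = exceeds done K≤l (staircase-lower z≤n gz)

  -- The data of a first excess in a staircase of m rows: the number q of rows
  -- after the hit, the rows before it and the (lowered) rows after it.
  Hits : ℕ → Set
  Hits m = Σ ℕ λ q → (q < m × K + q ≤ m) × Stairs below (m ∸ suc q) × Stairs below q

  prefix suffix : ∀ {m} → Hits m → List ℕ
  prefix (_ , _ , (ys , _) , _) = ys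
  suffix (_ , _ , _ , (zs , _)) = zs

  hits-≡ : ∀ {m} {h h′ : Hits m} → prefix h ≡ prefix h′ → suffix h ≡ suffix h′ → h ≡ h′
  hits-≡ {h = _ , (p , r) , P , (zs , refl , gz)} {h′ = _ , (p′ , r′) , P′ , (.zs , refl , gz′)} eqP refl
    rewrite ≤-irrelevant p p′ | ≤-irrelevant r r′ | stairs-≡ {s = P} {P′} eqP | staircase-irrelevant gz gz′ = refl

  rebuild : ∀ {m} → Stairs below m ⊎ Hits m → List ℕ
  rebuild (inj₁ (xs , _)) = xs
  rebuild (inj₂ h)        = insertHit 1 (prefix h) (suffix h)

  classify : ∀ {m xs} → Excess 0 1 xs → length xs ≡ m → Stairs below m ⊎ Hits m
  classify (within s) e = inj₁ (_ , e , s)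
  classify {m} (exceeds {ys} {zs} gy K≤ gz) e =
    inj₂ (length zs , proj₁ cut , (ys , proj₂ cut , gy) , (zs , refl , gz))
    where
    cut : (length zs < m × K + length zs ≤ m) × length ys ≡ m ∸ suc (length zs)
    cut = cut-arith (trans (sym (length-insertHit 1 ys zs)) e) K≤

  rebuild-classify : ∀ {m xs} (v : Excess 0 1 xs) (e : length xs ≡ m) → rebuild (classify v e) ≡ xs
  rebuild-classify (within _) _ = refl
  rebuild-classify (exceeds _ _ _) _ = refl

  classify-unique : ∀ {m xs} (v : Excess 0 1 xs) (e : length xs ≡ m) y → rebuild y ≡ xs → classify v e ≡ y
  classify-unique (within _) _ (inj₁ _) refl = cong inj₁ (stairs-≡ refl)
  classify-unique (within s) _ (inj₂ (_ , _ , (ys , _) , _)) refl = ⊥-elim (insertHit-not-below ys s)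
  classify-unique (exceeds {ys} _ _ _) _ (inj₁ (_ , _ , s)) refl = ⊥-elim (insertHit-not-below ys s)
  classify-unique (exceeds {ys} gy _ _) _ (inj₂ (_ , _ , (ys′ , _ , gy′) , _)) eq
    with insertHit-injective ys′ ys gy′ gy eq
  ... | eqP , eqS = cong inj₂ (hits-≡ (sym eqP) (sym eqS))

  split : ∀ {m} → Stairs ceiling m ↔ (Stairs below m ⊎ Hits m)
  split {m} = mk↔ₛ′ to from
    (λ y → classify-unique (excess (proj₂ (proj₂ (from y)))) _ y (sym (from-list y)))
    (λ { (xs , e , s) → stairs-≡ (trans (from-list (to (xs , e , s))) (rebuild-classify (excess s) e)) })
    where
    to : Stairs ceiling m → Stairs below m ⊎ Hits m
    to (xs , e , s) = classify (excess s) e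
    from : Stairs below m ⊎ Hits m → Stairs ceiling m
    from (inj₁ (xs , e , s)) = xs , e , staircase-mono (λ i _ → below≤ceiling i) s
    from (inj₂ (q , (q<m , K+q≤m) , (ys , ey , gy) , (zs , refl , gz))) =
      insertHit 1 ys zs ,
      trans (length-insertHit 1 ys zs) (proj₁ glue) ,
      insertHit-staircase z≤n gy (proj₂ glue) gz
      where
      glue : length ys + suc q ≡ m × K ≤ length ys + 1
      glue = glue-arith {K} ey q<m K+q≤m
    from-list : ∀ y → proj₁ (from y) ≡ rebuild y
    from-list (inj₁ _) = refl
    from-list (inj₂ (_ , _ , _ , (_ , refl , _))) = refl

dyck-coprime : ∀ N t → DyckPath t (t * N + 1) ↔ Stairs (λ l → N * l) (t ∸ 1)
dyck-coprime N t = ↔-trans dyck-stairs (stairs-ext (floor-coprime t N))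

disj-Σ : ∀ (F : ℕ → Set) K → Disj1to K F ↔ Σ ℕ (λ i → i < K × F (suc i))
disj-Σ F zero = mk↔ₛ′ (λ ()) (λ { (_ , () , _) }) (λ { (_ , () , _) }) (λ ())
disj-Σ F (suc K) = mk↔ₛ′ to from to∘from from∘to
  where
  open Inverse (disj-Σ F K) renaming (to to toK; from to fromK)
  widen : Σ ℕ (λ i → i < K × F (suc i)) → Σ ℕ (λ i → i < suc K × F (suc i))
  widen (i , i<K , x) = i , m<n⇒m<1+n i<K , x
  to : Disj1to (suc K) F → Σ ℕ (λ i → i < suc K × F (suc i))
  to (inj₁ d) = widen (toK d)
  to (inj₂ x) = K , ≤-refl , x
  from : Σ ℕ (λ i → i < suc K × F (suc i)) → Disj1to (suc K) F
  from (i , i<1+K , x) with m<1+n⇒m<n∨m≡n i<1+K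
  ... | inj₁ i<K = inj₁ (fromK (i , i<K , x))
  ... | inj₂ refl = inj₂ x
  to∘from : ∀ y → to (from y) ≡ y
  to∘from (i , i<1+K , x) with m<1+n⇒m<n∨m≡n i<1+K
  ... | inj₁ i<K = trans (cong widen (strictlyInverseˡ (i , i<K , x))) (cong (λ p → i , p , x) (<-irrelevant _ _))
  ... | inj₂ refl = cong (λ p → K , p , x) (<-irrelevant _ _)
  from-widen : ∀ y → from (widen y) ≡ inj₁ (fromK y)
  from-widen (i , i<K , x) with m<1+n⇒m<n∨m≡n (m<n⇒m<1+n i<K)
  ... | inj₁ i<K′ = cong (λ p → inj₁ (fromK (i , p , x))) (<-irrelevant _ _)
  ... | inj₂ refl = ⊥-elim (<-irrefl refl i<K)
  from∘to : ∀ d → from (to d) ≡ d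
  from∘to (inj₁ d) = trans (from-widen (toK d)) (cong inj₁ (strictlyInverseʳ d))
  from∘to (inj₂ x) with m<1+n⇒m<n∨m≡n (≤-refl {suc K})
  ... | inj₁ K<K = ⊥-elim (<-irrefl refl K<K)
  ... | inj₂ refl = refl

hits-range : ∀ k q → (q < 2 * suc k ∸ 1 × suc k + q ≤ 2 * suc k ∸ 1) ↔ q < suc k
hits-range k q = mk↔ₛ′ to from (λ _ → <-irrelevant _ _)
  (λ _ → cong₂ _,_ (<-irrelevant _ _) (≤-irrelevant _ _))
  where
  K = suc k
  -- 2K = (2K - 1) + 1 holds by computation, so K + q ≤ 2K - 1 says K + q < K + K.
  to : (q < 2 * K ∸ 1 × K + q ≤ 2 * K ∸ 1) → q < K
  to (_ , K+q≤) = subst (q <_) (+-identityʳ K) (+-cancelˡ-< K q (K + 0) (s≤s K+q≤))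
  from : q < K → (q < 2 * K ∸ 1 × K + q ≤ 2 * K ∸ 1)
  from q<K = ≤-trans (s≤s (m≤n+m q k)) K+q≤ , K+q≤
    where
    K+q≤ : K + q ≤ 2 * K ∸ 1
    K+q≤ = s≤s⁻¹ (+-monoʳ-< K (subst (q <_) (sym (+-identityʳ K)) q<K))

prefix-rows : ∀ a q → a ∸ 1 ∸ suc q ≡ a ∸ suc q ∸ 1
prefix-rows a q = begin
  a ∸ 1 ∸ suc q    ≡⟨ ∸-+-assoc a 1 (suc q) ⟩
  a ∸ (1 + suc q)  ≡⟨ cong (a ∸_) (+-comm 1 (suc q)) ⟩
  a ∸ (suc q + 1)  ≡⟨ sym (∸-+-assoc a (suc q) 1) ⟩
  a ∸ suc q ∸ 1    ∎
  where open ≡-Reasoning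

theorem2 : (k n : ℕ) →
    let a = 2 * suc k
        b = a * suc n + 2
    in DyckPath a b ↔
       (DyckPath a (a * suc n + 1)
         ⊎ Disj1to (suc k) (λ j → DyckPath (a ∸ j) ((a ∸ j) * suc n + 1) × DyckPath j (j * suc n + 1)))
theorem2 k n = begin
  DyckPath a (a * N + 2)
    ↔⟨ dyck-stairs ⟩
  Stairs (dyckCeiling a (a * N + 2)) (a ∸ 1)
    ↔⟨ stairs-ext (floor-even k N) ⟩
  Stairs ceiling (a ∸ 1)
    ↔⟨ split ⟩
  (Stairs below (a ∸ 1) ⊎ Hits (a ∸ 1))
    ↔⟨ ↔-sym (dyck-coprime N a) ⊎-↔ hits-as-pairs ⟩
  (DyckPath a (a * N + 1) ⊎ Σ ℕ (λ q → q < K × F (suc q)))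
    ↔⟨ ↔-refl ⊎-↔ ↔-sym (disj-Σ F K) ⟩
  (DyckPath a (a * N + 1) ⊎ Disj1to K F)
    ∎
  where
  open EquationalReasoning {k = bijection}
  N K a : ℕ
  N = suc n
  K = suc k
  a = 2 * K
  open FirstExcess K N
  F : ℕ → Set
  F j = DyckPath (a ∸ j) ((a ∸ j) * N + 1) × DyckPath j (j * N + 1)
  hits-as-pairs : Hits (a ∸ 1) ↔ Σ ℕ (λ q → q < K × F (suc q))
  hits-as-pairs = Σ-↔ ↔-refl (hits-range k _ ×-↔
    (↔-trans (stairs-resize (prefix-rows a _)) (↔-sym (dyck-coprime N _)) ×-↔ ↔-sym (dyck-coprime N _)))
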